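{- For each integer $k \ge 2$, the hypercube $Q_k$ is a royal-zero graph.
   Context: For a positive integer $k$, let $[k]=\{1,\dots,k\}$ and let $\mathcal{P}^*([k])$ denote the set of the $2^k-1$ nonempty subsets of $[k]$. For a connected graph $G$ of order at least $3$, an edge coloring $c:E(G)\to\mathcal{P}^*([k])$ induces the vertex coloring $c'(v)=\bigcup_{e\in E_v}c(e)$, where $E_v$ is the set of edges incident with $v$. The coloring $c$ is a strong royal $k$-edge coloring if $c'$ is injective on $V(G)$. The strong royal index $\mathrm{sroy}(G)$ is the minimum $k$ for which $G$ has a strong royal $k$-edge coloring. A connected graph $G$ of order $n\ge 3$, where $k$ is the unique integer with $2^{k-1}\le n\le 2^k-1$, is royal-zero if $\mathrm{sroy}(G)=k$. The hypercube $Q_1$ is $K_2$ and $Q_k=Q_{k-1}\,\Box\,K_2$ for $k\ge 2$. -}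

module Defs where

open import Data.Bool using (Bool; true; false; if_then_else_; _∧_)
open import Data.Nat using (ℕ; zero; suc; _≤_; _<_; _^_; _∸_)
open import Data.Fin using (Fin)
open import Data.Fin.Subset using (Subset; _∪_; ⊥; Nonempty)
open import Data.Vec using (Vec; []; _∷_)
open import Data.List using (List; []; _∷_; _++_; map; foldr; length)
open import Data.List.Membership.Propositional using (_∈_)
open import Data.List.Membership.Propositional.Properties using (∈-map⁺; ∈-map⁻; ∈-++⁺ˡ; ∈-++⁺ʳ; ∈-++⁻)
open import Data.List.Relation.Unary.Any using (here; there)
open import Data.List.Relation.Unary.Unique.Propositional using (Unique)
open import Data.List.Relation.Unary.Unique.Propositional.Properties using (map⁺; ++⁺)
import Data.List.Relation.Unary.AllPairs as AP
import Data.List.Relation.Unary.All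
open import Data.Product using (Σ; ∃; _×_; _,_)
open import Data.Sum using (_⊎_; inj₁; inj₂)
open import Relation.Nullary using (¬_)
open import Relation.Binary.PropositionalEquality using (_≡_; _≢_; refl; cong)

record Graph : Set₁ where
  field
    V        : Set
    verts    : List V
    unique   : Unique verts
    complete : ∀ v → v ∈ verts
    adj      : V → V → Bool
    adj-sym  : ∀ u v → adj u v ≡ adj v u
    adj-irr  : ∀ v → adj v v ≡ false

  order : ℕ
  order = length verts

  data Walk : V → V → Set where
    stay : ∀ {v} → Walk v v
    step : ∀ {u w v} → adj u w ≡ true → Walk w v → Walk u v

  Connected : Set
  Connected = ∀ u v → Walk u v

open Graph public

-- An edge coloring c : E(G) → P*([k]) is represented by a function on
-- ordered pairs of vertices which is symmetric on edges and takes
-- nonempty values on edges; its values on non-edges are irrelevant.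
record EdgeColoring (G : Graph) (k : ℕ) : Set where
  field
    col      : V G → V G → Subset k
    col-sym  : ∀ u v → adj G u v ≡ true → col u v ≡ col v u
    col-ne   : ∀ u v → adj G u v ≡ true → Nonempty (col u v)

  induced : V G → Subset k
  induced v = foldr (λ u acc → if adj G v u then col v u ∪ acc else acc) ⊥ (verts G)

open EdgeColoring public

IsStrongRoyal : {G : Graph} {k : ℕ} → EdgeColoring G k → Set
IsStrongRoyal {G} c = ∀ u v → induced c u ≡ induced c v → u ≡ v

HasStrongRoyal : Graph → ℕ → Set
HasStrongRoyal G k = Σ (EdgeColoring G k) IsStrongRoyal

SRoyIs : Graph → ℕ → Set
SRoyIs G k = HasStrongRoyal G k × (∀ j → 1 ≤ j → j < k → ¬ HasStrongRoyal G j)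

RoyalZero : Graph → Set
RoyalZero G = Connected G × 3 ≤ order G ×
  (∀ k → 1 ≤ k → 2 ^ (k ∸ 1) ≤ order G → order G ≤ 2 ^ k ∸ 1 → SRoyIs G k)

-- Hypercube Q_k on Vec Bool k; Q_k = Q_{k-1} □ K_2, the new K_2 factor
-- being the head coordinate.

eqB : Bool → Bool → Bool
eqB true true = true
eqB false false = true
eqB _ _ = false

eqV : ∀ {k} → Vec Bool k → Vec Bool k → Bool
eqV [] [] = true
eqV (x ∷ xs) (y ∷ ys) = eqB x y ∧ eqV xs ys

-- Q_0 is a single vertex; (x,xs) ~ (y,ys) in Q_{k-1} □ K_2 iff
-- (x = y and xs ~ ys) or (x ~ y in K_2, i.e. x ≠ y, and xs = ys)
qadj : ∀ {k} → Vec Bool k → Vec Bool k → Bool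
qadj [] [] = false
qadj (x ∷ xs) (y ∷ ys) = if eqB x y then qadj xs ys else eqV xs ys

allVecs : ∀ k → List (Vec Bool k)
allVecs zero = [] ∷ []
allVecs (suc k) = map (false ∷_) (allVecs k) ++ map (true ∷_) (allVecs k)

private
  eqB-sym : ∀ x y → eqB x y ≡ eqB y x
  eqB-sym true true = refl
  eqB-sym true false = refl
  eqB-sym false true = refl
  eqB-sym false false = refl

  eqV-sym : ∀ {k} (xs ys : Vec Bool k) → eqV xs ys ≡ eqV ys xs
  eqV-sym [] [] = refl
  eqV-sym (x ∷ xs) (y ∷ ys) rewrite eqB-sym x y | eqV-sym xs ys = refl

  qadj-sym : ∀ {k} (xs ys : Vec Bool k) → qadj xs ys ≡ qadj ys xs
  qadj-sym [] [] = refl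
  qadj-sym (x ∷ xs) (y ∷ ys) rewrite eqB-sym x y with eqB y x
  ... | true = qadj-sym xs ys
  ... | false = eqV-sym xs ys

  qadj-irr : ∀ {k} (xs : Vec Bool k) → qadj xs xs ≡ false
  qadj-irr [] = refl
  qadj-irr (true ∷ xs) = qadj-irr xs
  qadj-irr (false ∷ xs) = qadj-irr xs

  cons-inj : ∀ {k} {b} {xs ys : Vec Bool k} → (Vec._∷_ b xs) ≡ (b ∷ ys) → xs ≡ ys
  cons-inj refl = refl

  allVecs-complete : ∀ {k} (v : Vec Bool k) → v ∈ allVecs k
  allVecs-complete [] = here refl
  allVecs-complete {suc k} (false ∷ v) = ∈-++⁺ˡ (∈-map⁺ (false ∷_) (allVecs-complete v))
  allVecs-complete {suc k} (true ∷ v) =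
    ∈-++⁺ʳ (map (false ∷_) (allVecs k)) (∈-map⁺ (true ∷_) (allVecs-complete v))

  disj : ∀ {k} {v : Vec Bool (suc k)} →
         ¬ (v ∈ map (false ∷_) (allVecs k) × v ∈ map (true ∷_) (allVecs k))
  disj (p , q) with ∈-map⁻ (false ∷_) p | ∈-map⁻ (true ∷_) q
  ... | _ , _ , refl | _ , _ , ()

  allVecs-unique : ∀ k → Unique (allVecs k)
  allVecs-unique zero = Data.List.Relation.Unary.All.[] AP.∷ AP.[]
  allVecs-unique (suc k) =
    ++⁺ (map⁺ cons-inj (allVecs-unique k)) (map⁺ cons-inj (allVecs-unique k)) disj

Q : ℕ → Graph
Q k = record
  { V = Vec Bool k
  ; verts = allVecs k
  ; unique = allVecs-unique k
  ; complete = allVecs-complete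
  ; adj = qadj
  ; adj-sym = qadj-sym
  ; adj-irr = qadj-irr
  }

module Submission where

-- The hypercube Q_k (k ≥ 2) has order n = 2^k, so the level k' with
-- 2^(k'-1) ≤ n ≤ 2^k' - 1 is k' = k + 1, and we must show sroy(Q_k) = k + 1.
--
-- * Lower bound, valid for every graph without isolated vertices: the induced
--   colour of a vertex contains the colour of any incident edge, hence is a
--   nonempty subset of [j]; a strong royal j-colouring is then an injection of
--   V(G) into the 2^j - 1 nonempty subsets of [j], so order G < 2^j.
-- * Upper bound: colour the edge uw of Q_k by {0} ∪ {i + 1 | u_i = w_i = 1}.
--   For k ≥ 2 every coordinate i of v is witnessed by the neighbour obtained by
--   toggling another coordinate, so the induced colour of v is exactly
--   {0} ∪ {i + 1 | v_i = 1}, which determines v.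

open import Defs
open import Data.Nat using (ℕ; _≤_; zero; suc; _<_; _^_; _∸_; _+_; z≤n; s≤s)
open import Data.Nat.Properties
  using (≤-trans; ≤-refl; ≤-antisym; ≤-pred; <⇒≱; ≮⇒≥; ≰⇒>; m≤n⇒m≤1+n; ^-monoʳ-≤; ^-monoʳ-<;
         +-identityʳ; m^n≢0; m≤pred[n]⇒suc[m]≤n; module ≤-Reasoning)
open import Data.Bool using (Bool; true; false; not; if_then_else_)
open import Data.Fin using (Fin; zero; suc)
open import Data.Fin.Subset using (Subset; _∪_; _∩_; ⊥; _⊆_; Nonempty; inside)
  renaming (_∈_ to _∈ₛ_)
open import Data.Fin.Subset.Properties
  using (∉⊥; ⊥⊆; ⊆-antisym; p⊆p∪q; q⊆p∪q; x∈p∪q⁻; p∩q⊆p; x∈p∩q⁺; ∩-comm)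
open import Data.Vec using (Vec; []; _∷_; here; there; tail)
open import Data.List using (List; []; _∷_; _++_; map; foldr; length)
open import Data.List.Properties using (length-++; length-map)
open import Data.List.Membership.Propositional using (_∈_)
open import Data.List.Membership.Propositional.Properties using (∈-map⁻)
open import Data.List.Relation.Unary.Any using (here; there)
open import Data.List.Relation.Unary.Unique.Propositional using (Unique)
open import Data.List.Relation.Unary.Unique.Propositional.Properties using (map⁺)
import Data.List.Relation.Unary.AllPairs as AllPairs
import Data.List.Relation.Unary.All as All
open import Data.Product using (Σ; ∃; _×_; _,_; proj₂)
open import Data.Sum using ([_,_])
open import Data.Empty using (⊥-elim)
open import Function using (_∘_)
open import Relation.Nullary using (¬_)
open import Relation.Binary.PropositionalEquality
  using (_≡_; _≢_; refl; cong; cong₂; sym; trans; subst; module ≡-Reasoning)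

module InducedColour {G : Graph} {k : ℕ} (c : EdgeColoring G k) (v : V G) where

  gather : List (V G) → Subset k
  gather = foldr (λ u acc → if adj G v u then col c v u ∪ acc else acc) ⊥

  gather-grows : ∀ x L → gather L ⊆ gather (x ∷ L)
  gather-grows x L with adj G v x
  ... | true  = q⊆p∪q (col c v x) (gather L)
  ... | false = λ p∈ → p∈

  gather-⊇ : ∀ {u} L → u ∈ L → adj G v u ≡ true → col c v u ⊆ gather L
  gather-⊇ (x ∷ L) (here refl) vu rewrite vu = p⊆p∪q (gather L)
  gather-⊇ (x ∷ L) (there u∈L) vu = gather-grows x L ∘ gather-⊇ L u∈L vu

  gather-⊆ : ∀ {S} → (∀ u → adj G v u ≡ true → col c v u ⊆ S) → ∀ L → gather L ⊆ S
  gather-⊆ bound [] = ⊥⊆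
  gather-⊆ bound (x ∷ L) with adj G v x in vx
  ... | true  = [ bound x vx , gather-⊆ bound L ] ∘ x∈p∪q⁻ (col c v x) (gather L)
  ... | false = gather-⊆ bound L

induced-⊇ : ∀ {G k} (c : EdgeColoring G k) {v u} → adj G v u ≡ true → col c v u ⊆ induced c v
induced-⊇ {G} c {v} {u} = InducedColour.gather-⊇ c v (verts G) (complete G u)

induced-⊆ : ∀ {G k} (c : EdgeColoring G k) {v S} →
            (∀ u → adj G v u ≡ true → col c v u ⊆ S) → induced c v ⊆ S
induced-⊆ {G} c {v} bound = InducedColour.gather-⊆ c v bound (verts G)

induced-nonempty : ∀ {G k} (c : EdgeColoring G k) {v u} → adj G v u ≡ true → Nonempty (induced c v)
induced-nonempty c vu with col-ne c _ _ vu
... | p , p∈ = p , induced-⊇ c vu p∈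

module _ {A : Set} where

  delete : ∀ {x : A} (ys : List A) → x ∈ ys →
           Σ (List A) λ zs → suc (length zs) ≡ length ys × (∀ {z} → z ∈ ys → z ≢ x → z ∈ zs)
  delete (y ∷ ys) (here refl) = ys , refl , keep
    where
    keep : ∀ {z} → z ∈ y ∷ ys → z ≢ y → z ∈ ys
    keep (here refl) z≢y = ⊥-elim (z≢y refl)
    keep (there z∈)  _   = z∈
  delete (y ∷ ys) (there x∈) with delete ys x∈
  ... | zs , len , kept = y ∷ zs , cong suc len , keep
    where
    keep : ∀ {z} → z ∈ y ∷ ys → z ≢ _ → z ∈ y ∷ zs
    keep (here refl) _   = here refl
    keep (there z∈)  z≢x = there (kept z∈ z≢x)

  unique-length-≤ : ∀ (xs ys : List A) → Unique xs → (∀ {z} → z ∈ xs → z ∈ ys) → length xs ≤ length ys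
  unique-length-≤ [] ys _ _ = z≤n
  unique-length-≤ (x ∷ xs) ys (x∉xs AllPairs.∷ uxs) xs⊆ys with delete ys (xs⊆ys (here refl))
  ... | zs , len , kept = subst (suc (length xs) ≤_) len (s≤s (unique-length-≤ xs zs uxs xs⊆zs))
    where
    -- x occurs in xs only at its head, so the rest of xs survives deleting x.
    xs⊆zs : ∀ {z} → z ∈ xs → z ∈ zs
    xs⊆zs z∈ = kept (xs⊆ys (there z∈)) (λ { refl → All.lookup x∉xs z∈ refl })

-- `allVecs j` lists the 2^j subsets of [j] (and the 2^j vertices of Q_j).
length-allVecs : ∀ k → length (allVecs k) ≡ 2 ^ k
length-allVecs zero = refl
length-allVecs (suc k) = begin
  length (map (false ∷_) (allVecs k) ++ map (true ∷_) (allVecs k))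
    ≡⟨ length-++ (map (false ∷_) (allVecs k)) ⟩
  length (map (false ∷_) (allVecs k)) + length (map (true ∷_) (allVecs k))
    ≡⟨ cong₂ _+_ (trans (length-map _ (allVecs k)) (length-allVecs k))
                 (trans (length-map _ (allVecs k)) (length-allVecs k)) ⟩
  2 ^ k + 2 ^ k
    ≡⟨ cong (2 ^ k +_) (sym (+-identityʳ (2 ^ k))) ⟩
  2 ^ suc k ∎
  where open ≡-Reasoning

-- Lower bound: in a graph without isolated vertices, a strong royal j-colouring
-- injects the vertices into the nonempty subsets of [j], so order G < 2^j.
strongRoyal-order< : ∀ {G j} → (∀ v → ∃ λ u → adj G v u ≡ true) → HasStrongRoyal G j → order G < 2 ^ j
strongRoyal-order< {G} {j} neighbour (c , injective) = begin-strict
  order G                            ≡⟨ sym (length-map (induced c) (verts G)) ⟩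
  length (map (induced c) (verts G)) <⟨ unique-length-≤ colours (allVecs j) colours-unique
                                          (λ {z} _ → complete (Q j) z) ⟩
  length (allVecs j)                 ≡⟨ length-allVecs j ⟩
  2 ^ j                              ∎
  where
  open ≤-Reasoning
  -- The empty set together with all induced colours: pairwise distinct subsets of [j].
  colours : List (Subset j)
  colours = ⊥ ∷ map (induced c) (verts G)

  induced-≢⊥ : ∀ {s} → s ∈ map (induced c) (verts G) → ⊥ ≢ s
  induced-≢⊥ s∈ ⊥≡s with ∈-map⁻ (induced c) s∈
  ... | v , _ , refl with induced-nonempty c (proj₂ (neighbour v))
  ...   | p , p∈ = ∉⊥ (subst (p ∈ₛ_) (sym ⊥≡s) p∈)

  colours-unique : Unique colours
  colours-unique = All.tabulate induced-≢⊥ AllPairs.∷ map⁺ (injective _ _) (unique G)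

toggle : ∀ {k} → Fin k → Vec Bool k → Vec Bool k
toggle zero    (x ∷ xs) = not x ∷ xs
toggle (suc i) (x ∷ xs) = x ∷ toggle i xs

eqB-refl : ∀ x → eqB x x ≡ true
eqB-refl true  = refl
eqB-refl false = refl

eqV-refl : ∀ {k} (xs : Vec Bool k) → eqV xs xs ≡ true
eqV-refl []       = refl
eqV-refl (x ∷ xs) rewrite eqB-refl x = eqV-refl xs

qadj-toggle : ∀ {k} (i : Fin k) (v : Vec Bool k) → qadj v (toggle i v) ≡ true
qadj-toggle zero    (true  ∷ xs) = eqV-refl xs
qadj-toggle zero    (false ∷ xs) = eqV-refl xs
qadj-toggle (suc i) (true  ∷ xs) = qadj-toggle i xs
qadj-toggle (suc i) (false ∷ xs) = qadj-toggle i xs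

toggle-keeps : ∀ {k} {i j : Fin k} {v : Vec Bool k} → i ≢ j → i ∈ₛ v → i ∈ₛ toggle j v
toggle-keeps {j = zero}  i≢j here       = ⊥-elim (i≢j refl)
toggle-keeps {j = suc j} i≢j here       = here
toggle-keeps {j = zero}  i≢j (there i∈) = there i∈
toggle-keeps {j = suc j} i≢j (there i∈) = there (toggle-keeps (i≢j ∘ cong suc) i∈)

order-Q : ∀ k → order (Q k) ≡ 2 ^ k
order-Q = length-allVecs

liftWalk : ∀ {k} (x : Bool) {a b : Vec Bool k} → Walk (Q k) a b → Walk (Q (suc k)) (x ∷ a) (x ∷ b)
liftWalk x     stay       = stay
liftWalk true  (step e w) = step e (liftWalk true w)
liftWalk false (step e w) = step e (liftWalk false w)

Q-connected : ∀ k → Connected (Q k)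
Q-connected zero    []          []          = stay
Q-connected (suc k) (true  ∷ u) (true  ∷ w) = liftWalk true  (Q-connected k u w)
Q-connected (suc k) (false ∷ u) (false ∷ w) = liftWalk false (Q-connected k u w)
Q-connected (suc k) (true  ∷ u) (false ∷ w) = step (eqV-refl u) (liftWalk false (Q-connected k u w))
Q-connected (suc k) (false ∷ u) (true  ∷ w) = step (eqV-refl u) (liftWalk true  (Q-connected k u w))

-- Upper bound: the edge uw gets colour {0} ∪ {i + 1 | i ∈ u ∩ w} ⊆ [k + 1].
cubeColouring : ∀ k → EdgeColoring (Q k) (suc k)
cubeColouring k = record
  { col     = λ u w → inside ∷ (u ∩ w)
  ; col-sym = λ u w _ → cong (inside ∷_) (∩-comm u w)
  ; col-ne  = λ _ _ _ → zero , here
  }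

-- Some coordinate different from i; this is where k ≥ 2 is needed.
another : ∀ {m} → Fin (suc (suc m)) → Fin (suc (suc m))
another zero    = suc zero
another (suc _) = zero

another-≢ : ∀ {m} (i : Fin (suc (suc m))) → i ≢ another i
another-≢ zero    ()
another-≢ (suc _) ()

cubeColouring-induced : ∀ m (v : Vec Bool (suc (suc m))) →
                        induced (cubeColouring (suc (suc m))) v ≡ inside ∷ v
cubeColouring-induced m v = ⊆-antisym (induced-⊆ c edge-⊆) ⊇
  where
  c : EdgeColoring (Q (suc (suc m))) (suc (suc (suc m)))
  c = cubeColouring (suc (suc m))

  edge-⊆ : ∀ u → qadj v u ≡ true → inside ∷ (v ∩ u) ⊆ inside ∷ v
  edge-⊆ u _ here       = here
  edge-⊆ u _ (there i∈) = there (p∩q⊆p v u i∈)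

  ⊇ : inside ∷ v ⊆ induced c v
  ⊇ here       = induced-⊇ c (qadj-toggle zero v) here
  ⊇ (there {i = i} i∈v) = induced-⊇ c (qadj-toggle (another i) v)
                            (there (x∈p∩q⁺ (i∈v , toggle-keeps (another-≢ i) i∈v)))

cube-strongRoyal : ∀ m → HasStrongRoyal (Q (suc (suc m))) (suc (suc (suc m)))
cube-strongRoyal m = cubeColouring _ , λ u w same → cong tail
  (trans (sym (cubeColouring-induced m u)) (trans same (cubeColouring-induced m w)))

cube-no-strongRoyal : ∀ {k j} → 1 ≤ k → j ≤ k → ¬ HasStrongRoyal (Q k) j
cube-no-strongRoyal {suc k} {j} _ j≤k royal =
  <⇒≱ (subst (_< 2 ^ j) (order-Q (suc k)) (strongRoyal-order< neighbour royal)) (^-monoʳ-≤ 2 j≤k)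
  where
  neighbour : ∀ v → ∃ λ u → qadj v u ≡ true
  neighbour v = toggle zero v , qadj-toggle zero v

2^-reflects-≤ : ∀ {a b} → 2 ^ a ≤ 2 ^ b → a ≤ b
2^-reflects-≤ 2^a≤2^b = ≮⇒≥ (λ b<a → <⇒≱ (^-monoʳ-< 2 (s≤s (s≤s z≤n)) b<a) 2^a≤2^b)

2^-reflects-< : ∀ {a b} → 2 ^ a < 2 ^ b → a < b
2^-reflects-< 2^a<2^b = ≰⇒> (λ b≤a → <⇒≱ 2^a<2^b (^-monoʳ-≤ 2 b≤a))

level-of-power : ∀ k k' → 1 ≤ k' → 2 ^ (k' ∸ 1) ≤ 2 ^ k → 2 ^ k ≤ 2 ^ k' ∸ 1 → k' ≡ suc k
level-of-power k (suc m) _ lower upper =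
  cong suc (≤-antisym (2^-reflects-≤ lower) (≤-pred (2^-reflects-< 2^k<2^[1+m])))
  where
  2^k<2^[1+m] : 2 ^ k < 2 ^ suc m
  2^k<2^[1+m] = m≤pred[n]⇒suc[m]≤n {{m^n≢0 2 (suc m)}} upper

corollary2p5 : ∀ (k : ℕ) → 2 ≤ k → RoyalZero (Q k)
corollary2p5 k@(suc (suc m)) 2≤k@(s≤s (s≤s _)) = Q-connected k , three≤order , sroy-is-level
  where
  three≤order : 3 ≤ order (Q k)
  three≤order = subst (3 ≤_) (sym (order-Q k)) (≤-trans (m≤n⇒m≤1+n ≤-refl) (^-monoʳ-≤ 2 2≤k))

  sroy-is-level : ∀ k' → 1 ≤ k' → 2 ^ (k' ∸ 1) ≤ order (Q k) → order (Q k) ≤ 2 ^ k' ∸ 1 → SRoyIs (Q k) k'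
  sroy-is-level k' 1≤k' lower upper
    with refl ← level-of-power k k' 1≤k' (subst (2 ^ (k' ∸ 1) ≤_) (order-Q k) lower)
                                       (subst (_≤ 2 ^ k' ∸ 1) (order-Q k) upper)
    = cube-strongRoyal m , λ j _ j<k' → cube-no-strongRoyal (s≤s z≤n) (≤-pred j<k')
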